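{- Let $G$ be a complete $k$-partite graph in which every partite set has more than one vertex. Then $\rho_T(G)=k$.
   Context: Graphs are finite and simple. A complete $k$-partite graph is one whose vertex set is partitioned into $k$ independent sets (partite sets) such that two vertices are adjacent iff they lie in different partite sets. For $u,v\in(\mathbb{R}\cup\{\infty\})^m$, $u\odot v=\min_i(u_i+v_i)$. $\rho_T(G)$ is the minimum $m$ such that there is $f:V(G)\to(\mathbb{R}\cup\{\infty\})^m$ and a threshold $t>0$ with, for all distinct $x,y$, $xy\in E(G)$ iff $f(x)\odot f(y)\ge t$.
   Formalization: Each representation f takes values in (ℚ ∪ {∞})^m and the threshold t is rational, in place of $(\mathbb{R}\cup\{\infty\})^m$ and a real threshold. -}

module Defs where

open import Data.Nat using (ℕ)
open import Data.Fin using (Fin)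
open import Data.Vec using (Vec; foldr′; zipWith)
open import Data.Rational using (ℚ; 0ℚ; _<_; _≤_) renaming (_+_ to _+ℚ_; _⊓_ to _⊓ℚ_)
open import Data.Unit using (⊤)
open import Data.Product using (Σ; ∃; _×_)
open import Relation.Binary.PropositionalEquality using (_≡_; _≢_)
open import Relation.Nullary using (¬_)
open import Function.Bundles using (_⇔_)

record Graph : Set₁ where
  field
    n      : ℕ
    Adj    : Fin n → Fin n → Set
    sym    : ∀ {x y} → Adj x y → Adj y x
    irrefl : ∀ {x} → ¬ Adj x x

open Graph public

CompleteMultipartiteBig : Graph → ℕ → Set
CompleteMultipartiteBig G k =
  Σ (Fin (n G) → Fin k) λ p →
    (∀ (j : Fin k) → ∃ λ x → ∃ λ y → x ≢ y × p x ≡ j × p y ≡ j)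
    × (∀ x y → x ≢ y → (Adj G x y ⇔ p x ≢ p y))

data ℚ∞ : Set where
  fin : ℚ → ℚ∞
  ∞   : ℚ∞

_+∞_ : ℚ∞ → ℚ∞ → ℚ∞
fin a +∞ fin b = fin (a +ℚ b)
fin a +∞ ∞     = ∞
∞     +∞ _     = ∞

_⊓∞_ : ℚ∞ → ℚ∞ → ℚ∞
fin a ⊓∞ fin b = fin (a ⊓ℚ b)
fin a ⊓∞ ∞     = fin a
∞     ⊓∞ b     = b

_⊙_ : ∀ {m} → Vec ℚ∞ m → Vec ℚ∞ m → ℚ∞
u ⊙ v = foldr′ _⊓∞_ ∞ (zipWith _+∞_ u v)

_≤∞_ : ℚ → ℚ∞ → Set
t ≤∞ fin a = t ≤ a
t ≤∞ ∞     = ⊤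

TropRep : Graph → ℕ → Set
TropRep G m =
  Σ (Fin (n G) → Vec ℚ∞ m) λ f →
  Σ ℚ λ t →
    (0ℚ < t)
    × (∀ x y → x ≢ y → (Adj G x y ⇔ t ≤∞ (f x ⊙ f y)))

ρT≡ : Graph → ℕ → Set
ρT≡ G r = TropRep G r × (∀ m → TropRep G m → r Data.Nat.≤ m)

{-# OPTIONS --safe #-}
-- Upper bound: send a vertex of class j to the tropical unit vector with 0 in
-- coordinate j and ∞ elsewhere; two such vectors have tropical product ∞ when
-- their classes differ and 0 when they agree.
-- Lower bound: pick non-adjacent x_j ≠ y_j in each class j. Some coordinate i_j
-- has f(x_j)_i + f(y_j)_i < t. If i_j = i_j' for j ≠ j', then x_j ~ x_j' and
-- y_j ~ y_j' give two sums ≥ t at that coordinate whose total equals the total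
-- of the two sums < t; so j ↦ i_j is injective and k ≤ m.
module Submission where

open import Defs hiding (sym)
open import Algebra.Bundles using (CommutativeMonoid)
open import Data.Bool using (if_then_else_)
open import Data.Empty using (⊥)
open import Data.Fin using (Fin; zero; suc; _≟_)
open import Data.Fin.Properties using (¬∀⟶∃¬; injective⇒≤)
open import Data.Nat using (ℕ)
open import Data.Product using (∃; _×_; _,_; proj₁; proj₂; uncurry)
open import Data.Rational using (ℚ; 0ℚ; 1ℚ; _<_; _+_)
import Data.Rational.Properties as ℚ
open import Data.Unit using (tt)
open import Data.Vec using (Vec; []; _∷_; lookup; tabulate)
open import Data.Vec.Properties using (lookup∘tabulate)
open import Function using (_∘_; _$_)
open import Function.Bundles using (_⇔_; mk⇔; Equivalence)
import Function.Properties.Equivalence as ⇔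
open import Relation.Binary.PropositionalEquality using (_≡_; _≢_; refl; sym; trans; cong; subst)
open import Relation.Nullary using (¬_; Dec; does; yes; no)
open import Relation.Nullary.Decidable using (dec-true; dec-false; decidable-stable)
open import Algebra.Properties.CommutativeSemigroup
  (CommutativeMonoid.commutativeSemigroup ℚ.+-0-commutativeMonoid) using (interchange)

open Equivalence using (to; from)

_≤∞?_ : (t : ℚ) (e : ℚ∞) → Dec (t ≤∞ e)
t ≤∞? fin a = t ℚ.≤? a
t ≤∞? ∞     = yes tt

≤∞-⊓∞ : ∀ {t} a b → t ≤∞ (a ⊓∞ b) ⇔ (t ≤∞ a × t ≤∞ b)
≤∞-⊓∞ (fin a) (fin b) = mk⇔ (λ h → ℚ.p≤q⊓r⇒p≤q a b h , ℚ.p≤q⊓r⇒p≤r a b h) (uncurry ℚ.⊓-glb)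
≤∞-⊓∞ (fin a) ∞       = mk⇔ (_, tt) proj₁
≤∞-⊓∞ ∞       b       = mk⇔ (tt ,_) proj₂

≤∞-⊙ : ∀ {t m} (u v : Vec ℚ∞ m) → t ≤∞ (u ⊙ v) ⇔ (∀ i → t ≤∞ (lookup u i +∞ lookup v i))
≤∞-⊙     []      []      = mk⇔ (λ _ ()) (λ _ → tt)
≤∞-⊙ {t} (a ∷ u) (b ∷ v) = mk⇔ to′ from′
  where
  to′ : t ≤∞ ((a ∷ u) ⊙ (b ∷ v)) → ∀ i → t ≤∞ (lookup (a ∷ u) i +∞ lookup (b ∷ v) i)
  to′ h with to (≤∞-⊓∞ (a +∞ b) (u ⊙ v)) h
  ... | h₀ , hₛ = λ { zero → h₀ ; (suc i) → to (≤∞-⊙ u v) hₛ i }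
  from′ : (∀ i → t ≤∞ (lookup (a ∷ u) i +∞ lookup (b ∷ v) i)) → t ≤∞ ((a ∷ u) ⊙ (b ∷ v))
  from′ h = from (≤∞-⊓∞ (a +∞ b) (u ⊙ v)) (h zero , from (≤∞-⊙ u v) (h ∘ suc))

≰∞-⊙ : ∀ {t m} (u v : Vec ℚ∞ m) → ¬ t ≤∞ (u ⊙ v) → ∃ λ i → ¬ t ≤∞ (lookup u i +∞ lookup v i)
≰∞-⊙ {t} {m} u v t≰u⊙v =
  ¬∀⟶∃¬ m _ (λ i → t ≤∞? (lookup u i +∞ lookup v i)) (t≰u⊙v ∘ from (≤∞-⊙ u v))

≤∞-interchange : ∀ {t} a b c d → t ≤∞ (a +∞ c) → t ≤∞ (b +∞ d) →
                 ¬ t ≤∞ (a +∞ b) → ¬ t ≤∞ (c +∞ d) → ⊥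
≤∞-interchange ∞       _       _       _       _ _ t≰ab _   = t≰ab tt
≤∞-interchange (fin a) ∞       _       _       _ _ t≰ab _   = t≰ab tt
≤∞-interchange (fin a) (fin b) ∞       _       _ _ _    t≰cd = t≰cd tt
≤∞-interchange (fin a) (fin b) (fin c) ∞       _ _ _    t≰cd = t≰cd tt
≤∞-interchange {t} (fin a) (fin b) (fin c) (fin d) t≤ac t≤bd t≰ab t≰cd =
  ℚ.<-irrefl refl $ begin-strict
    (a + b) + (c + d) <⟨ ℚ.+-mono-< (ℚ.≰⇒> t≰ab) (ℚ.≰⇒> t≰cd) ⟩
    t + t             ≤⟨ ℚ.+-mono-≤ t≤ac t≤bd ⟩
    (a + c) + (b + d) ≡⟨ interchange a c b d ⟩
    (a + b) + (c + d) ∎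
  where open ℚ.≤-Reasoning

adj⇒≢ : ∀ (G : Graph) {x y} → Adj G x y → x ≢ y
adj⇒≢ G xy refl = irrefl G xy

record CrossAdjacentNonEdges (G : Graph) (k : ℕ) : Set where
  field
    left right     : Fin k → Fin (n G)
    left≢right     : ∀ j → left j ≢ right j
    left≁right     : ∀ j → ¬ Adj G (left j) (right j)
    left-adjacent  : ∀ {j j′} → j ≢ j′ → Adj G (left j) (left j′)
    right-adjacent : ∀ {j j′} → j ≢ j′ → Adj G (right j) (right j′)

crossAdjacentNonEdges⇒≤ : ∀ {G k m} → CrossAdjacentNonEdges G k → TropRep G m → k Data.Nat.≤ m
crossAdjacentNonEdges⇒≤ {G} {k} {m} P (f , t , _ , rep) = injective⇒≤ {f = separator} separator-injective
  where
  open CrossAdjacentNonEdges P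

  sum : Fin (n G) → Fin (n G) → Fin m → ℚ∞
  sum x y i = lookup (f x) i +∞ lookup (f y) i

  adjacent⇒≤∞ : ∀ {x y} → Adj G x y → ∀ i → t ≤∞ sum x y i
  adjacent⇒≤∞ xy = to (≤∞-⊙ (f _) (f _)) (to (rep _ _ (adj⇒≢ G xy)) xy)

  separating : ∀ j → ∃ λ i → ¬ t ≤∞ sum (left j) (right j) i
  separating j = ≰∞-⊙ (f (left j)) (f (right j)) (left≁right j ∘ from (rep _ _ (left≢right j)))

  separator : Fin k → Fin m
  separator = proj₁ ∘ separating

  separator-injective : ∀ {j j′} → separator j ≡ separator j′ → j ≡ j′
  separator-injective {j} {j′} eq = decidable-stable (j ≟ j′) λ j≢j′ →
    ≤∞-interchange _ _ _ _
      (adjacent⇒≤∞ (left-adjacent j≢j′) (separator j))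
      (adjacent⇒≤∞ (right-adjacent j≢j′) (separator j))
      (proj₂ (separating j))
      (subst (λ i → ¬ t ≤∞ sum (left j′) (right j′) i) (sym eq) (proj₂ (separating j′)))

completeMultipartite⇒crossAdjacentNonEdges : ∀ {G k} → CompleteMultipartiteBig G k →
                                             CrossAdjacentNonEdges G k
completeMultipartite⇒crossAdjacentNonEdges {G} {k} (p , classes , adj) = record
  { left           = left
  ; right          = right
  ; left≢right     = λ j → proj₁ (proj₂ (proj₂ (classes j)))
  ; left≁right     = λ j xy →
      to (adj _ _ (proj₁ (proj₂ (proj₂ (classes j))))) xy (trans (p-left j) (sym (p-right j)))
  ; left-adjacent  = across p-left
  ; right-adjacent = across p-right
  }
  where
  left right : Fin k → Fin (n G)
  left  j = proj₁ (classes j)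
  right j = proj₁ (proj₂ (classes j))
  p-left : ∀ j → p (left j) ≡ j
  p-left j = proj₁ (proj₂ (proj₂ (proj₂ (classes j))))
  p-right : ∀ j → p (right j) ≡ j
  p-right j = proj₂ (proj₂ (proj₂ (proj₂ (classes j))))

  across : ∀ {x : Fin k → Fin (n G)} → (∀ j → p (x j) ≡ j) → ∀ {j j′} → j ≢ j′ → Adj G (x j) (x j′)
  across {x} px {j} {j′} j≢j′ = from (adj _ _ (λ eq → j≢j′ (different (cong p eq)))) (j≢j′ ∘ different)
    where
    different : p (x j) ≡ p (x j′) → j ≡ j′
    different eq = trans (sym (px j)) (trans eq (px j′))

unitVec : ∀ {k} → Fin k → Vec ℚ∞ k
unitVec j = tabulate λ i → if does (i ≟ j) then fin 0ℚ else ∞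

lookup-unitVec-≡ : ∀ {k} (j : Fin k) → lookup (unitVec j) j ≡ fin 0ℚ
lookup-unitVec-≡ j = trans (lookup∘tabulate _ j) (cong (if_then fin 0ℚ else ∞) (dec-true (j ≟ j) refl))

lookup-unitVec-≢ : ∀ {k} {i j : Fin k} → i ≢ j → lookup (unitVec j) i ≡ ∞
lookup-unitVec-≢ {i = i} {j} i≢j =
  trans (lookup∘tabulate _ i) (cong (if_then fin 0ℚ else ∞) (dec-false (i ≟ j) i≢j))

unitVec-+∞-≢ : ∀ {k} {j j′ : Fin k} → j ≢ j′ → ∀ i → lookup (unitVec j) i +∞ lookup (unitVec j′) i ≡ ∞
unitVec-+∞-≢ {j = j} j≢j′ i with i ≟ j
... | yes refl rewrite lookup-unitVec-≡ i | lookup-unitVec-≢ j≢j′ = refl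
... | no i≢j   rewrite lookup-unitVec-≢ i≢j = refl

≤∞-unitVec-⊙ : ∀ {k t} {j j′ : Fin k} → 0ℚ < t → t ≤∞ (unitVec j ⊙ unitVec j′) ⇔ j ≢ j′
≤∞-unitVec-⊙ {t = t} {j} {j′} 0<t = mk⇔ to′ from′
  where
  to′ : t ≤∞ (unitVec j ⊙ unitVec j′) → j ≢ j′
  to′ h refl with to (≤∞-⊙ (unitVec j) (unitVec j)) h j
  ... | t≤0 rewrite lookup-unitVec-≡ j = ℚ.<-irrefl refl (ℚ.<-≤-trans 0<t t≤0)
  from′ : j ≢ j′ → t ≤∞ (unitVec j ⊙ unitVec j′)
  from′ j≢j′ = from (≤∞-⊙ (unitVec j) (unitVec j′)) λ i → subst (t ≤∞_) (sym (unitVec-+∞-≢ j≢j′ i)) tt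

partition⇒tropRep : ∀ (G : Graph) {k} (p : Fin (n G) → Fin k) →
                    (∀ x y → x ≢ y → (Adj G x y ⇔ p x ≢ p y)) → TropRep G k
partition⇒tropRep G p adj =
  unitVec ∘ p , 1ℚ , ℚ.positive⁻¹ 1ℚ ,
  λ x y x≢y → ⇔.trans (adj x y x≢y) (⇔.sym (≤∞-unitVec-⊙ (ℚ.positive⁻¹ 1ℚ)))

mainTheorem17 : (G : Graph) (k : ℕ) → CompleteMultipartiteBig G k → ρT≡ G k
mainTheorem17 G k H@(p , _ , adj) =
  partition⇒tropRep G p adj ,
  λ _ → crossAdjacentNonEdges⇒≤ (completeMultipartite⇒crossAdjacentNonEdges {G} H)
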